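{- Let $k=2K+1\ge5$ be an odd integer and let $i$ be any integer (possibly negative or larger than $k-2$). Then $F_k^{(i)}(x,y)=G_k^{(i)}(x,y)$, where $$F_k^{(i)}(x,y)=\sum_{s=1}^{K-1}\left(\frac{ -2}{2s-1}\sum_{n=0}^{k-2s}\binom{i}{k-2s-n}\binom{n+2s-2}{n}B_n\right)x^{2K-2s}y^{2s-1},$$ $$G_k^{(i)}(x,y)=\sum_{s=1}^{K-1}\left(\frac{2}{2s-1}\sum_{n=0}^{k-2s}\binom{k-2-i}{k-2s-n}\binom{n+2s-2}{n}B_n\right)x^{2K-2s}y^{2s-1}.$$
   Context: $B_n$ is the $n$th Bernoulli number, defined by $\frac{t}{e^t-1}=\sum_{n\ge0}B_n\frac{t^n}{n!}$ (so $B_1=-\tfrac12$). For an integer $a$ (possibly negative) and an integer $m\ge0$, $\binom{a}{m}=\frac{a(a-1)\cdots(a-m+1)}{m!}$; in particular for negative $a$, $\binom{a}{m}=(-1)^m\binom{ -a+m-1}{m}$, and for $a\ge0$ this is the usual binomial coefficient (zero when $m>a$). In the formulas above all lower indices are nonnegative. -}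

module Defs where

open import Data.Nat as ℕ using (ℕ; zero; suc)
open import Data.Nat.Combinatorics using (_C_)
open import Data.Integer as ℤ using (ℤ; +_; -[1+_])
open import Data.Rational using (ℚ; 0ℚ; 1ℚ; _+_; _*_; -_; _/_)
open import Data.List using (List; []; _∷_; _++_; [_])

Σ< : ℕ → (ℕ → ℚ) → ℚ
Σ< zero    f = 0ℚ
Σ< (suc n) f = Σ< n f + f n

-- Σ from a to b inclusive (empty if b < a); here: Σ_{j=lo}^{hi} f j
Σ[_⋯_] : ℕ → ℕ → (ℕ → ℚ) → ℚ
Σ[ lo ⋯ hi ] f = Σ< (suc hi ℕ.∸ lo) (λ j → f (lo ℕ.+ j))

_^_ : ℚ → ℕ → ℚ
x ^ zero  = 1ℚ
x ^ suc n = x * (x ^ n)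

nth : List ℚ → ℕ → ℚ
nth []       _       = 0ℚ
nth (x ∷ xs) zero    = x
nth (x ∷ xs) (suc j) = nth xs j

-- next Bernoulli number from the list [B_0, ..., B_{n-1}]:
-- B_n = -(1/(n+1)) Σ_{j<n} C(n+1,j) B_j   (n ≥ 1), B_0 = 1.
-- This is equivalent to t/(e^t-1) = Σ B_n t^n/n!, with B_1 = -1/2.
nextB : ℕ → List ℚ → ℚ
nextB zero    _ = 1ℚ
nextB (suc m) l =
  - ((+ 1 / suc (suc m)) * Σ< (suc m) (λ j → (+ (suc (suc m) C j) / 1) * nth l j))

bernoulliList : ℕ → List ℚ
bernoulliList zero    = []
bernoulliList (suc n) = bernoulliList n ++ [ nextB n (bernoulliList n) ]

B : ℕ → ℚ
B n = nth (bernoulliList (suc n)) n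

-- generalized binomial coefficient binom(a, m) = a(a-1)...(a-m+1)/m!  for a ∈ ℤ
binom : ℤ → ℕ → ℚ
binom a zero    = 1ℚ
binom a (suc m) = binom a m * ((a ℤ.- + m) / suc m)

F : ℕ → ℤ → ℚ → ℚ → ℚ
F K i x y = Σ[ 1 ⋯ K ℕ.∸ 1 ] λ s →
  let k = 2 ℕ.* K ℕ.+ 1 in
  ((-[1+ 1 ] / suc (2 ℕ.* (s ℕ.∸ 1)))   -- -2/(2s-1)
    * Σ[ 0 ⋯ k ℕ.∸ 2 ℕ.* s ] (λ n →
        binom i (k ℕ.∸ 2 ℕ.* s ℕ.∸ n)
        * (+ ((n ℕ.+ 2 ℕ.* s ℕ.∸ 2) C n) / 1)
        * B n))
  * (x ^ (2 ℕ.* K ℕ.∸ 2 ℕ.* s)) * (y ^ (2 ℕ.* s ℕ.∸ 1))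

G : ℕ → ℤ → ℚ → ℚ → ℚ
G K i x y = Σ[ 1 ⋯ K ℕ.∸ 1 ] λ s →
  let k = 2 ℕ.* K ℕ.+ 1 in
  ((+ 2 / suc (2 ℕ.* (s ℕ.∸ 1)))        -- 2/(2s-1)
    * Σ[ 0 ⋯ k ℕ.∸ 2 ℕ.* s ] (λ n →
        binom ((+ k ℤ.- + 2) ℤ.- i) (k ℕ.∸ 2 ℕ.* s ℕ.∸ n)
        * (+ ((n ℕ.+ 2 ℕ.* s ℕ.∸ 2) C n) / 1)
        * B n))
  * (x ^ (2 ℕ.* K ℕ.∸ 2 ℕ.* s)) * (y ^ (2 ℕ.* s ℕ.∸ 1))

{-# OPTIONS --safe #-}
module Submission where

-- Write Φ m r a = Σ_{n ≤ m} binom(a, m - n) C(n + r, n) B_n.  The inner sums of F and G at s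
-- are Φ m r i and Φ m r (k - 2 - i) with m = k - 2s odd and r = 2s - 2, so m + r = k - 2, and the
-- theorem is the reflection  Φ m r a = (-1)^m Φ m r (m + r - a), which holds for all m and r.
-- By Pascal's rule Φ (m+1) r (a+1) - Φ (m+1) r a = Φ m r a, so inductively the reflection defect
-- of Φ (m+1) r is invariant under a ↦ a + 1, hence constant, and it suffices to see that it
-- vanishes at a = 0.  There Φ m r 0 = C(m+r, m) B_m and Φ m r (m+r) = C(m+r, m) Σ_n C(m,n) B_n,
-- so it remains to know Σ_n C(m,n) B_n = (-1)^m B_m.  That is the case r = 0 read at a = m, and
-- for r = 0 the constant defect vanishes because its sum over a = 0..m is (1 - (-1)^m) Σ_a Φ m 0 a,
-- a sum that telescopes to Σ_n C(m+1,n) B_n - B_{m+1} = 0 by the recurrence defining B.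

open import Data.Nat as ℕ using (ℕ; zero; suc; _∸_; _≤_; _<_; s≤s; _!)
import Data.Nat.DivMod as ℕDM
import Data.Nat.Properties as ℕP
open import Data.Nat.Properties using (_!≢0; _!*_!≢0)
open import Data.Nat.Combinatorics using (_C_)
import Data.Nat.Combinatorics as ℕC
open import Data.Integer as ℤ using (ℤ; +_; -[1+_])
import Data.Integer.Properties as ℤP
open import Data.Integer.Tactic.RingSolver using (solve-∀)
open import Data.Nat.Tactic.RingSolver using () renaming (solve-∀ to ℕsolve-∀)
open import Data.Rational as ℚ using (ℚ; 0ℚ; 1ℚ; _+_; _*_; -_; _-_; _/_; toℚᵘ)
import Data.Rational.Properties as ℚP
import Data.Rational.Unnormalised as ℚᵘ
import Data.Rational.Unnormalised.Properties as ℚᵘP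
open import Data.Rational.Solver using (module +-*-Solver)
open +-*-Solver using (solve; _:+_; _:*_; :-_; _:-_; _:=_; con)
open import Algebra.Properties.Group ℚP.+-0-group using (x∙y⁻¹≈ε⇒x≈y; identityʳ-unique)
open import Data.List using ([]; _∷_; _++_; [_]; length)
open import Data.List.Properties using (length-++)
open import Data.Product using (_,_)
open import Data.Sum using (inj₁; inj₂)
open import Relation.Binary.PropositionalEquality hiding ([_])
open import Defs

ι : ℤ → ℚ
ι z = z / 1

-- z / suc n unfolds to fromℚᵘ (mkℚᵘ z n).
toℚᵘ-/ : ∀ z n → toℚᵘ (z / suc n) ℚᵘ.≃ ℚᵘ.mkℚᵘ z n
toℚᵘ-/ z n = ℚP.toℚᵘ-fromℚᵘ (ℚᵘ.mkℚᵘ z n)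

ι-homo-+ : ∀ a b → ι (a ℤ.+ b) ≡ ι a + ι b
ι-homo-+ a b = ℚP.toℚᵘ-injective (begin
  toℚᵘ (ι (a ℤ.+ b))                  ≈⟨ toℚᵘ-/ (a ℤ.+ b) 0 ⟩
  ℚᵘ.mkℚᵘ (a ℤ.+ b) 0                 ≈⟨ ℚᵘ.*≡* (over-1 a b) ⟩
  ℚᵘ.mkℚᵘ a 0 ℚᵘ.+ ℚᵘ.mkℚᵘ b 0        ≈⟨ ℚᵘP.+-cong (toℚᵘ-/ a 0) (toℚᵘ-/ b 0) ⟨
  toℚᵘ (ι a) ℚᵘ.+ toℚᵘ (ι b)          ≈⟨ ℚP.toℚᵘ-homo-+ (ι a) (ι b) ⟨
  toℚᵘ (ι a + ι b)                    ∎)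
  where
  open ℚᵘP.≃-Reasoning
  over-1 : ∀ a b → (a ℤ.+ b) ℤ.* + 1 ≡ (a ℤ.* + 1 ℤ.+ b ℤ.* + 1) ℤ.* + 1
  over-1 = solve-∀

ι-homo-* : ∀ a b → ι (a ℤ.* b) ≡ ι a * ι b
ι-homo-* a b = ℚP.toℚᵘ-injective (begin
  toℚᵘ (ι (a ℤ.* b))                  ≈⟨ toℚᵘ-/ (a ℤ.* b) 0 ⟩
  ℚᵘ.mkℚᵘ a 0 ℚᵘ.* ℚᵘ.mkℚᵘ b 0        ≈⟨ ℚᵘP.*-cong (toℚᵘ-/ a 0) (toℚᵘ-/ b 0) ⟨
  toℚᵘ (ι a) ℚᵘ.* toℚᵘ (ι b)          ≈⟨ ℚP.toℚᵘ-homo-* (ι a) (ι b) ⟨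
  toℚᵘ (ι a * ι b)                    ∎)
  where open ℚᵘP.≃-Reasoning

z/n*n≡z : ∀ z n → (z / suc n) * ι (+ suc n) ≡ ι z
z/n*n≡z z n = ℚP.toℚᵘ-injective (begin
  toℚᵘ ((z / suc n) * ι (+ suc n))             ≈⟨ ℚP.toℚᵘ-homo-* (z / suc n) (ι (+ suc n)) ⟩
  toℚᵘ (z / suc n) ℚᵘ.* toℚᵘ (ι (+ suc n))     ≈⟨ ℚᵘP.*-cong (toℚᵘ-/ z n) (toℚᵘ-/ (+ suc n) 0) ⟩
  ℚᵘ.mkℚᵘ z n ℚᵘ.* ℚᵘ.mkℚᵘ (+ suc n) 0         ≈⟨ ℚᵘ.*≡* (cancel z n) ⟩
  ℚᵘ.mkℚᵘ z 0                                  ≈⟨ toℚᵘ-/ z 0 ⟨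
  toℚᵘ (ι z)                                   ∎)
  where
  open ℚᵘP.≃-Reasoning
  cancel : ∀ z n → z ℤ.* + suc n ℤ.* + 1 ≡ z ℤ.* + suc (n ℕ.* 1)
  cancel z n rewrite ℕP.*-identityʳ n = ℤP.*-identityʳ (z ℤ.* + suc n)

*-cancelʳ-ι-suc : ∀ n {x y} → x * ι (+ suc n) ≡ y * ι (+ suc n) → x ≡ y
*-cancelʳ-ι-suc n {x} {y} eq = begin
  x          ≡⟨ expand x ⟨
  x * c * u  ≡⟨ cong (_* u) eq ⟩
  y * c * u  ≡⟨ expand y ⟩
  y          ∎
  where
  open ≡-Reasoning
  c = ι (+ suc n)
  u = + 1 / suc n
  expand : ∀ x → x * c * u ≡ x
  expand x = begin
    x * c * u    ≡⟨ solve 3 (λ x c u → x :* c :* u := x :* (u :* c)) refl x c u ⟩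
    x * (u * c)  ≡⟨ cong (x *_) (z/n*n≡z (+ 1) n) ⟩
    x * 1ℚ       ≡⟨ ℚP.*-identityʳ x ⟩
    x            ∎

Σ<-cong : ∀ n {f g : ℕ → ℚ} → (∀ j → j < n → f j ≡ g j) → Σ< n f ≡ Σ< n g
Σ<-cong zero    f≗g = refl
Σ<-cong (suc n) f≗g =
  cong₂ _+_ (Σ<-cong n (λ j j<n → f≗g j (ℕP.m<n⇒m<1+n j<n))) (f≗g n (ℕP.n<1+n n))

Σ<-+ : ∀ n (f g : ℕ → ℚ) → Σ< n (λ j → f j + g j) ≡ Σ< n f + Σ< n g
Σ<-+ zero    f g = refl
Σ<-+ (suc n) f g rewrite Σ<-+ n f g =
  solve 4 (λ a b c d → (a :+ b) :+ (c :+ d) := (a :+ c) :+ (b :+ d)) refl (Σ< n f) (Σ< n g) (f n) (g n)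

Σ<-*ˡ : ∀ n c (f : ℕ → ℚ) → Σ< n (λ j → c * f j) ≡ c * Σ< n f
Σ<-*ˡ zero    c f = sym (ℚP.*-zeroʳ c)
Σ<-*ˡ (suc n) c f rewrite Σ<-*ˡ n c f = sym (ℚP.*-distribˡ-+ c (Σ< n f) (f n))

Σ<-linear : ∀ n c (f g : ℕ → ℚ) → Σ< n (λ j → f j - c * g j) ≡ Σ< n f - c * Σ< n g
Σ<-linear zero    c f g = solve 1 (λ c → con 0ℚ := con 0ℚ :- c :* con 0ℚ) refl c
Σ<-linear (suc n) c f g rewrite Σ<-linear n c f g =
  solve 5 (λ A B c x y → (A :- c :* B) :+ (x :- c :* y) := (A :+ x) :- c :* (B :+ y))
    refl (Σ< n f) (Σ< n g) c (f n) (g n)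

Σ<-const : ∀ n c → Σ< n (λ _ → c) ≡ ι (+ n) * c
Σ<-const zero    c = sym (ℚP.*-zeroˡ c)
Σ<-const (suc n) c rewrite Σ<-const n c = begin
  ι (+ n) * c + c        ≡⟨ solve 2 (λ a c → a :* c :+ c := (con 1ℚ :+ a) :* c) refl (ι (+ n)) c ⟩
  (1ℚ + ι (+ n)) * c     ≡⟨ cong (_* c) (ι-homo-+ (+ 1) (+ n)) ⟨
  ι (+ suc n) * c        ∎
  where open ≡-Reasoning

Σ<-sucˡ : ∀ n (f : ℕ → ℚ) → Σ< (suc n) f ≡ f 0 + Σ< n (λ j → f (suc j))
Σ<-sucˡ zero    f = trans (ℚP.+-identityˡ (f 0)) (sym (ℚP.+-identityʳ (f 0)))
Σ<-sucˡ (suc n) f rewrite Σ<-sucˡ n f = ℚP.+-assoc (f 0) _ _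

Σ<-reverse : ∀ n (f : ℕ → ℚ) → Σ< n (λ j → f (n ∸ suc j)) ≡ Σ< n f
Σ<-reverse zero    f = refl
Σ<-reverse (suc n) f = begin
  Σ< n (λ j → f (n ∸ j)) + f (n ∸ n)
    ≡⟨ cong₂ _+_ (Σ<-cong n (λ j j<n → cong f (ℕP.+-∸-assoc 1 j<n))) (cong f (ℕP.n∸n≡0 n)) ⟩
  Σ< n (λ j → f (suc (n ∸ suc j))) + f 0
    ≡⟨ cong (_+ f 0) (Σ<-reverse n (λ j → f (suc j))) ⟩
  Σ< n (λ j → f (suc j)) + f 0
    ≡⟨ ℚP.+-comm _ (f 0) ⟩
  f 0 + Σ< n (λ j → f (suc j))
    ≡⟨ Σ<-sucˡ n f ⟨
  Σ< (suc n) f ∎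
  where open ≡-Reasoning

Σ<-telescope : ∀ (g f : ℕ → ℚ) → (∀ n → g (suc n) ≡ g n + f n) → ∀ n → g n ≡ g 0 + Σ< n f
Σ<-telescope g f step zero    = sym (ℚP.+-identityʳ (g 0))
Σ<-telescope g f step (suc n) = begin
  g (suc n)                   ≡⟨ step n ⟩
  g n + f n                   ≡⟨ cong (_+ f n) (Σ<-telescope g f step n) ⟩
  g 0 + Σ< n f + f n          ≡⟨ ℚP.+-assoc (g 0) (Σ< n f) (f n) ⟩
  g 0 + (Σ< n f + f n)        ∎
  where open ≡-Reasoning

length-bernoulliList : ∀ n → length (bernoulliList n) ≡ n
length-bernoulliList zero    = refl
length-bernoulliList (suc n) =
  trans (length-++ (bernoulliList n)) (trans (cong (ℕ._+ 1) (length-bernoulliList n)) (ℕP.+-comm n 1))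

nth-++ˡ : ∀ l x j → j < length l → nth (l ++ [ x ]) j ≡ nth l j
nth-++ˡ (y ∷ l) x zero    _       = refl
nth-++ˡ (y ∷ l) x (suc j) (s≤s p) = nth-++ˡ l x j p

nth-++-length : ∀ l x → nth (l ++ [ x ]) (length l) ≡ x
nth-++-length []      x = refl
nth-++-length (y ∷ l) x = nth-++-length l x

nth-bernoulliList : ∀ n j → j < n → nth (bernoulliList n) j ≡ B j
nth-bernoulliList (suc n) j (s≤s j≤n) with ℕP.m≤n⇒m<n∨m≡n j≤n
... | inj₂ refl = refl
... | inj₁ j<n  =
  trans (nth-++ˡ (bernoulliList n) _ j (subst (j <_) (sym (length-bernoulliList n)) j<n))
        (nth-bernoulliList n j j<n)

B-suc : ∀ m → B (suc m) ≡ - ((+ 1 / suc (suc m)) * Σ< (suc m) (λ j → ι (+ (suc (suc m) C j)) * B j))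
B-suc m = begin
  nth (l ++ [ x ]) (suc m)       ≡⟨ cong (nth (l ++ [ x ])) (length-bernoulliList (suc m)) ⟨
  nth (l ++ [ x ]) (length l)    ≡⟨ nth-++-length l x ⟩
  x                              ≡⟨ cong (λ t → - ((+ 1 / suc (suc m)) * t))
                                      (Σ<-cong (suc m) (λ j j<n → cong (ι (+ (suc (suc m) C j)) *_) (nth-bernoulliList (suc m) j j<n))) ⟩
  - ((+ 1 / suc (suc m)) * Σ< (suc m) (λ j → ι (+ (suc (suc m) C j)) * B j)) ∎
  where
  open ≡-Reasoning
  l = bernoulliList (suc m)
  x = nextB (suc m) l

ΣCB : ℕ → ℚ
ΣCB m = Σ< (suc m) (λ n → ι (+ (m C n)) * B n)

ΣCB≡B : ∀ m → ΣCB (suc (suc m)) ≡ B (suc (suc m))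
ΣCB≡B m = begin
  S + ι (+ (M C suc m)) * B (suc m) + ι (+ (M C M)) * B M
    ≡⟨ cong₂ (λ a b → S + ι (+ a) * B (suc m) + ι (+ b) * B M) M-C-suc-m (ℕC.nCn≡1 M) ⟩
  S + ι (+ M) * B (suc m) + 1ℚ * B M
    ≡⟨ cong (λ t → S + ι (+ M) * t + 1ℚ * B M) (B-suc m) ⟩
  S + ι (+ M) * (- (q * S)) + 1ℚ * B M
    ≡⟨ solve 4 (λ S c q b → S :+ c :* (:- (q :* S)) :+ con 1ℚ :* b := S :- (q :* c) :* S :+ b)
         refl S (ι (+ M)) q (B M) ⟩
  S - (q * ι (+ M)) * S + B M
    ≡⟨ cong (λ t → S - t * S + B M) (z/n*n≡z (+ 1) (suc m)) ⟩
  S - 1ℚ * S + B M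
    ≡⟨ solve 2 (λ S b → S :- con 1ℚ :* S :+ b := b) refl S (B M) ⟩
  B M ∎
  where
  open ≡-Reasoning
  M = suc (suc m)
  q = + 1 / M
  S = Σ< (suc m) (λ j → ι (+ (M C j)) * B j)
  M-C-suc-m : M C suc m ≡ M
  M-C-suc-m = trans (sym (ℕC.nCk≡nC[n∸k] {1} {M} (s≤s ℕ.z≤n))) (ℕC.nC1≡n M)

binom-suc-* : ∀ a m → binom a (suc m) * ι (+ suc m) ≡ binom a m * ι (a ℤ.- + m)
binom-suc-* a m = trans (ℚP.*-assoc (binom a m) _ _) (cong (binom a m *_) (z/n*n≡z (a ℤ.- + m) m))

binom-pascal : ∀ a j → binom (+ 1 ℤ.+ a) (suc j) ≡ binom a (suc j) + binom a j
binom-pascal a zero = begin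
  1ℚ * ι (+ 1 ℤ.+ a ℤ.- + 0)     ≡⟨ cong (λ z → 1ℚ * ι z) (shift a) ⟩
  1ℚ * ι ((a ℤ.- + 0) ℤ.+ + 1)   ≡⟨ cong (1ℚ *_) (ι-homo-+ (a ℤ.- + 0) (+ 1)) ⟩
  1ℚ * (ι (a ℤ.- + 0) + 1ℚ)      ≡⟨ solve 1 (λ x → con 1ℚ :* (x :+ con 1ℚ) := con 1ℚ :* x :+ con 1ℚ)
                                      refl (ι (a ℤ.- + 0)) ⟩
  1ℚ * ι (a ℤ.- + 0) + 1ℚ        ∎
  where
  open ≡-Reasoning
  shift : ∀ a → + 1 ℤ.+ a ℤ.- + 0 ≡ (a ℤ.- + 0) ℤ.+ + 1
  shift = solve-∀
binom-pascal a (suc j) = *-cancelʳ-ι-suc (suc j) (begin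
  binom (+ 1 ℤ.+ a) (suc (suc j)) * c  ≡⟨ binom-suc-* (+ 1 ℤ.+ a) (suc j) ⟩
  binom (+ 1 ℤ.+ a) (suc j) * ι (+ 1 ℤ.+ a ℤ.- + suc j)
                                       ≡⟨ cong₂ _*_ (binom-pascal a j) (cong ι (shift a (+ j))) ⟩
  (X + Y) * u                          ≡⟨ ℚP.*-distribʳ-+ u X Y ⟩
  X * u + Y * u                        ≡⟨ cong (λ t → X * u + t) (binom-suc-* a j) ⟨
  X * u + X * v                        ≡⟨ ℚP.*-distribˡ-+ X u v ⟨
  X * (u + v)                          ≡⟨ cong (X *_) u+v≡w+c ⟩
  X * (w + c)                          ≡⟨ ℚP.*-distribˡ-+ X w c ⟩
  X * w + X * c                        ≡⟨ cong (_+ X * c) (binom-suc-* a (suc j)) ⟨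
  binom a (suc (suc j)) * c + X * c    ≡⟨ ℚP.*-distribʳ-+ c (binom a (suc (suc j))) X ⟨
  (binom a (suc (suc j)) + X) * c      ∎)
  where
  open ≡-Reasoning
  X = binom a (suc j)
  Y = binom a j
  u = ι (a ℤ.- + j)
  v = ι (+ suc j)
  w = ι (a ℤ.- + suc j)
  c = ι (+ suc (suc j))
  shift : ∀ a b → + 1 ℤ.+ a ℤ.- (+ 1 ℤ.+ b) ≡ a ℤ.- b
  shift = solve-∀
  regroup : ∀ a b → (a ℤ.- b) ℤ.+ (+ 1 ℤ.+ b) ≡ (a ℤ.- (+ 1 ℤ.+ b)) ℤ.+ (+ 2 ℤ.+ b)
  regroup = solve-∀
  u+v≡w+c : u + v ≡ w + c
  u+v≡w+c = begin
    u + v                                  ≡⟨ ι-homo-+ (a ℤ.- + j) (+ suc j) ⟨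
    ι ((a ℤ.- + j) ℤ.+ (+ 1 ℤ.+ + j))      ≡⟨ cong ι (regroup a (+ j)) ⟩
    ι ((a ℤ.- + suc j) ℤ.+ (+ 2 ℤ.+ + j))  ≡⟨ ι-homo-+ (a ℤ.- + suc j) (+ suc (suc j)) ⟩
    w + c                                  ∎

binom-0 : ∀ j → binom (+ 0) (suc j) ≡ 0ℚ
binom-0 zero    = refl
binom-0 (suc j) rewrite binom-0 j = ℚP.*-zeroˡ ((+ 0 ℤ.- + suc j) / suc (suc j))

binom-ℕ : ∀ a j → binom (+ a) j ≡ ι (+ (a C j))
binom-ℕ zero    zero    = refl
binom-ℕ zero    (suc j) = binom-0 j
binom-ℕ (suc a) zero    = refl
binom-ℕ (suc a) (suc j) = begin
  binom (+ suc a) (suc j)                ≡⟨ binom-pascal (+ a) j ⟩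
  binom (+ a) (suc j) + binom (+ a) j    ≡⟨ cong₂ _+_ (binom-ℕ a (suc j)) (binom-ℕ a j) ⟩
  ι (+ (a C suc j)) + ι (+ (a C j))      ≡⟨ ι-homo-+ (+ (a C suc j)) (+ (a C j)) ⟨
  ι (+ (a C suc j ℕ.+ a C j))            ≡⟨ cong (λ t → ι (+ t)) (trans (ℕP.+-comm (a C suc j) (a C j))
                                              (ℕC.nCk+nC[k+1]≡[n+1]C[k+1] a j)) ⟩
  ι (+ (suc a C suc j))                  ∎
  where open ≡-Reasoning

nCk*[k!*[n∸k]!]≡n! : ∀ {n k} → k ≤ n → (n C k) ℕ.* (k ! ℕ.* (n ∸ k) !) ≡ n !
nCk*[k!*[n∸k]!]≡n! {n} {k} k≤n =
  trans (cong (ℕ._* (k ! ℕ.* (n ∸ k) !)) (ℕC.nCk≡n!/k![n-k]! k≤n))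
        (ℕDM.m/n*n≡m {{k !* (n ∸ k) !≢0}} (ℕC.k![n∸k]!∣n! k≤n))

[M+r]C[M∸n]*[n+r]Cn≡[M+r]CM*MCn : ∀ M r n → n ≤ M →
  ((M ℕ.+ r) C (M ∸ n)) ℕ.* ((n ℕ.+ r) C n) ≡ ((M ℕ.+ r) C M) ℕ.* (M C n)
[M+r]C[M∸n]*[n+r]Cn≡[M+r]CM*MCn M r n n≤M =
  ℕP.*-cancelʳ-≡ _ _ (a !) {{a !≢0}} (ℕP.*-cancelʳ-≡ _ _ (n !) {{n !≢0}}
    (ℕP.*-cancelʳ-≡ _ _ (r !) {{r !≢0}} (trans lhs≡N! (sym rhs≡N!))))
  where
  open ≡-Reasoning
  N = M ℕ.+ r
  a = M ∸ n
  N∸a≡n+r : N ∸ a ≡ n ℕ.+ r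
  N∸a≡n+r = trans (ℕP.+-∸-comm r (ℕP.m∸n≤m M n)) (cong (ℕ._+ r) (ℕP.m∸[m∸n]≡n n≤M))
  regroupˡ : ∀ x y p q s → x ℕ.* y ℕ.* p ℕ.* q ℕ.* s ≡ x ℕ.* p ℕ.* (y ℕ.* (q ℕ.* s))
  regroupˡ = ℕsolve-∀
  regroupʳ : ∀ x y p q s → x ℕ.* y ℕ.* p ℕ.* q ℕ.* s ≡ x ℕ.* (y ℕ.* (q ℕ.* p)) ℕ.* s
  regroupʳ = ℕsolve-∀
  lhs≡N! : (N C a) ℕ.* ((n ℕ.+ r) C n) ℕ.* a ! ℕ.* n ! ℕ.* r ! ≡ N !
  lhs≡N! = begin
    (N C a) ℕ.* ((n ℕ.+ r) C n) ℕ.* a ! ℕ.* n ! ℕ.* r !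
      ≡⟨ regroupˡ (N C a) ((n ℕ.+ r) C n) (a !) (n !) (r !) ⟩
    (N C a) ℕ.* a ! ℕ.* (((n ℕ.+ r) C n) ℕ.* (n ! ℕ.* r !))
      ≡⟨ cong (λ t → (N C a) ℕ.* a ! ℕ.* (((n ℕ.+ r) C n) ℕ.* (n ! ℕ.* t !))) (ℕP.m+n∸m≡n n r) ⟨
    (N C a) ℕ.* a ! ℕ.* (((n ℕ.+ r) C n) ℕ.* (n ! ℕ.* (n ℕ.+ r ∸ n) !))
      ≡⟨ cong ((N C a) ℕ.* a ! ℕ.*_) (nCk*[k!*[n∸k]!]≡n! (ℕP.m≤m+n n r)) ⟩
    (N C a) ℕ.* a ! ℕ.* (n ℕ.+ r) !
      ≡⟨ cong (λ t → (N C a) ℕ.* a ! ℕ.* t !) N∸a≡n+r ⟨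
    (N C a) ℕ.* a ! ℕ.* (N ∸ a) !
      ≡⟨ ℕP.*-assoc (N C a) (a !) ((N ∸ a) !) ⟩
    (N C a) ℕ.* (a ! ℕ.* (N ∸ a) !)
      ≡⟨ nCk*[k!*[n∸k]!]≡n! (ℕP.≤-trans (ℕP.m∸n≤m M n) (ℕP.m≤m+n M r)) ⟩
    N ! ∎
  rhs≡N! : (N C M) ℕ.* (M C n) ℕ.* a ! ℕ.* n ! ℕ.* r ! ≡ N !
  rhs≡N! = begin
    (N C M) ℕ.* (M C n) ℕ.* a ! ℕ.* n ! ℕ.* r !
      ≡⟨ regroupʳ (N C M) (M C n) (a !) (n !) (r !) ⟩
    (N C M) ℕ.* ((M C n) ℕ.* (n ! ℕ.* a !)) ℕ.* r !
      ≡⟨ cong (λ t → (N C M) ℕ.* t ℕ.* r !) (nCk*[k!*[n∸k]!]≡n! n≤M) ⟩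
    (N C M) ℕ.* M ! ℕ.* r !
      ≡⟨ cong (λ t → (N C M) ℕ.* M ! ℕ.* t !) (ℕP.m+n∸m≡n M r) ⟨
    (N C M) ℕ.* M ! ℕ.* (N ∸ M) !
      ≡⟨ ℕP.*-assoc (N C M) (M !) ((N ∸ M) !) ⟩
    (N C M) ℕ.* (M ! ℕ.* (N ∸ M) !)
      ≡⟨ nCk*[k!*[n∸k]!]≡n! (ℕP.m≤m+n M r) ⟩
    N ! ∎

[-1]^m*[-1]^m≡1 : ∀ m → (- 1ℚ) ^ m * (- 1ℚ) ^ m ≡ 1ℚ
[-1]^m*[-1]^m≡1 zero    = refl
[-1]^m*[-1]^m≡1 (suc m) =
  trans (solve 1 (λ s → (:- con 1ℚ :* s) :* (:- con 1ℚ :* s) := s :* s) refl ((- 1ℚ) ^ m))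
        ([-1]^m*[-1]^m≡1 m)

[-1]^[t+t]≡1 : ∀ t → (- 1ℚ) ^ (t ℕ.+ t) ≡ 1ℚ
[-1]^[t+t]≡1 zero    = refl
[-1]^[t+t]≡1 (suc t) rewrite ℕP.+-suc t t =
  trans (solve 1 (λ s → :- con 1ℚ :* (:- con 1ℚ :* s) := s) refl ((- 1ℚ) ^ (t ℕ.+ t)))
        ([-1]^[t+t]≡1 t)

weight : ℕ → ℕ → ℚ
weight r n = ι (+ ((n ℕ.+ r) C n))

weight-0 : ∀ n → weight 0 n ≡ 1ℚ
weight-0 n = cong (λ k → ι (+ k)) (trans (cong (_C n) (ℕP.+-identityʳ n)) (ℕC.nCn≡1 n))

Φ : ℕ → ℕ → ℤ → ℚ
Φ m r a = Σ< (suc m) (λ n → binom a (m ∸ n) * weight r n * B n)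

Φ-pascal : ∀ m r a → Φ (suc m) r (+ 1 ℤ.+ a) ≡ Φ (suc m) r a + Φ m r a
Φ-pascal m r a = begin
  Σ< (suc m) (λ n → binom a′ (suc m ∸ n) * weight r n * B n) + binom a′ (m ∸ m) * weight r (suc m) * B (suc m)
    ≡⟨ cong₂ _+_ (Σ<-cong (suc m) split) (cong (λ c → c * weight r (suc m) * B (suc m)) top) ⟩
  Σ< (suc m) (λ n → P n + Q n) + T
    ≡⟨ cong (_+ T) (Σ<-+ (suc m) P Q) ⟩
  Σ< (suc m) P + Φ m r a + T
    ≡⟨ solve 3 (λ x y z → x :+ y :+ z := x :+ z :+ y) refl (Σ< (suc m) P) (Φ m r a) T ⟩
  Σ< (suc m) P + T + Φ m r a ∎
  where
  open ≡-Reasoning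
  a′ = + 1 ℤ.+ a
  P = λ n → binom a (suc m ∸ n) * weight r n * B n
  Q = λ n → binom a (m ∸ n) * weight r n * B n
  T = binom a (m ∸ m) * weight r (suc m) * B (suc m)
  top : binom a′ (m ∸ m) ≡ binom a (m ∸ m)
  top rewrite ℕP.n∸n≡0 m = refl
  split : ∀ n → n < suc m → binom a′ (suc m ∸ n) * weight r n * B n ≡ P n + Q n
  split n (s≤s n≤m) rewrite ℕP.+-∸-assoc 1 n≤m | binom-pascal a (m ∸ n) =
    solve 4 (λ x y w b → (x :+ y) :* w :* b := x :* w :* b :+ y :* w :* b)
      refl (binom a (suc (m ∸ n))) (binom a (m ∸ n)) (weight r n) (B n)

Φ-at-0 : ∀ m r → Φ m r (+ 0) ≡ weight r m * B m
Φ-at-0 m r = begin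
  Σ< m (λ n → binom (+ 0) (m ∸ n) * weight r n * B n) + binom (+ 0) (m ∸ m) * weight r m * B m
    ≡⟨ cong₂ _+_ (Σ<-cong m vanish) (cong (λ k → binom (+ 0) k * weight r m * B m) (ℕP.n∸n≡0 m)) ⟩
  Σ< m (λ _ → 0ℚ) + 1ℚ * weight r m * B m
    ≡⟨ cong (_+ 1ℚ * weight r m * B m) (trans (Σ<-const m 0ℚ) (ℚP.*-zeroʳ (ι (+ m)))) ⟩
  0ℚ + 1ℚ * weight r m * B m
    ≡⟨ solve 2 (λ w b → con 0ℚ :+ con 1ℚ :* w :* b := w :* b) refl (weight r m) (B m) ⟩
  weight r m * B m ∎
  where
  open ≡-Reasoning
  vanish : ∀ n → n < m → binom (+ 0) (m ∸ n) * weight r n * B n ≡ 0ℚ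
  vanish n n<m rewrite ℕP.+-∸-assoc 1 n<m | binom-0 (m ∸ suc n) =
    trans (cong (_* B n) (ℚP.*-zeroˡ (weight r n))) (ℚP.*-zeroˡ (B n))

Φ-at-top : ∀ m r → Φ m r (+ (m ℕ.+ r)) ≡ weight r m * ΣCB m
Φ-at-top m r = trans (Σ<-cong (suc m) factor) (Σ<-*ˡ (suc m) (weight r m) (λ n → ι (+ (m C n)) * B n))
  where
  open ≡-Reasoning
  ι-homo-ℕ* : ∀ x y → ι (+ (x ℕ.* y)) ≡ ι (+ x) * ι (+ y)
  ι-homo-ℕ* x y = trans (cong ι (ℤP.pos-* x y)) (ι-homo-* (+ x) (+ y))
  factor : ∀ n → n < suc m → binom (+ (m ℕ.+ r)) (m ∸ n) * weight r n * B n ≡ weight r m * (ι (+ (m C n)) * B n)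
  factor n (s≤s n≤m) = begin
    binom (+ (m ℕ.+ r)) (m ∸ n) * weight r n * B n
      ≡⟨ cong (λ t → t * weight r n * B n) (binom-ℕ (m ℕ.+ r) (m ∸ n)) ⟩
    ι (+ ((m ℕ.+ r) C (m ∸ n))) * ι (+ ((n ℕ.+ r) C n)) * B n
      ≡⟨ cong (_* B n) (ι-homo-ℕ* ((m ℕ.+ r) C (m ∸ n)) ((n ℕ.+ r) C n)) ⟨
    ι (+ (((m ℕ.+ r) C (m ∸ n)) ℕ.* ((n ℕ.+ r) C n))) * B n
      ≡⟨ cong (λ t → ι (+ t) * B n) ([M+r]C[M∸n]*[n+r]Cn≡[M+r]CM*MCn m r n n≤m) ⟩
    ι (+ (((m ℕ.+ r) C m) ℕ.* (m C n))) * B n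
      ≡⟨ cong (_* B n) (ι-homo-ℕ* ((m ℕ.+ r) C m) (m C n)) ⟩
    weight r m * ι (+ (m C n)) * B n
      ≡⟨ ℚP.*-assoc (weight r m) (ι (+ (m C n))) (B n) ⟩
    weight r m * (ι (+ (m C n)) * B n) ∎

Reflective : ℕ → ℕ → Set
Reflective m r = ∀ a → Φ m r a ≡ (- 1ℚ) ^ m * Φ m r (+ (m ℕ.+ r) ℤ.- a)

reflection-defect : ℕ → ℕ → ℤ → ℚ
reflection-defect m r a = Φ m r a - (- 1ℚ) ^ m * Φ m r (+ (m ℕ.+ r) ℤ.- a)

reflective-0 : ∀ r → Reflective 0 r
reflective-0 r a = sym (ℚP.*-identityˡ (Φ 0 r a))

reflection-defect-shift : ∀ m r → Reflective m r →
  ∀ a → reflection-defect (suc m) r (+ 1 ℤ.+ a) ≡ reflection-defect (suc m) r a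
reflection-defect-shift m r reflect a = begin
  Φ (suc m) r (+ 1 ℤ.+ a) - s′ * Φ (suc m) r b
    ≡⟨ cong (λ t → t - s′ * Φ (suc m) r b) (Φ-pascal m r a) ⟩
  Φ (suc m) r a + Φ m r a - s′ * Φ (suc m) r b
    ≡⟨ cong (λ t → Φ (suc m) r a + t - s′ * Φ (suc m) r b)
         (trans (reflect a) (cong (λ c → s * Φ m r c) (shift (+ (m ℕ.+ r)) a))) ⟩
  Φ (suc m) r a + s * Φ m r b - s′ * Φ (suc m) r b
    ≡⟨ solve 4 (λ x y z s → x :+ s :* y :- (:- con 1ℚ :* s) :* z := x :- (:- con 1ℚ :* s) :* (z :+ y))
         refl (Φ (suc m) r a) (Φ m r b) (Φ (suc m) r b) s ⟩
  Φ (suc m) r a - s′ * (Φ (suc m) r b + Φ m r b)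
    ≡⟨ cong (λ t → Φ (suc m) r a - s′ * t) (Φ-pascal m r b) ⟨
  Φ (suc m) r a - s′ * Φ (suc m) r (+ 1 ℤ.+ b)
    ≡⟨ cong (λ c → Φ (suc m) r a - s′ * Φ (suc m) r c) (unshift (+ (m ℕ.+ r)) a) ⟩
  reflection-defect (suc m) r a ∎
  where
  open ≡-Reasoning
  s = (- 1ℚ) ^ m
  s′ = (- 1ℚ) ^ suc m
  b = + (suc m ℕ.+ r) ℤ.- (+ 1 ℤ.+ a)
  shift : ∀ x a → x ℤ.- a ≡ (+ 1 ℤ.+ x) ℤ.- (+ 1 ℤ.+ a)
  shift = solve-∀
  unshift : ∀ x a → + 1 ℤ.+ ((+ 1 ℤ.+ x) ℤ.- (+ 1 ℤ.+ a)) ≡ (+ 1 ℤ.+ x) ℤ.- a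
  unshift = solve-∀

shift-invariant⇒constant : ∀ (h : ℤ → ℚ) → (∀ a → h (+ 1 ℤ.+ a) ≡ h a) → ∀ a → h a ≡ h (+ 0)
shift-invariant⇒constant h inv (+ zero)       = refl
shift-invariant⇒constant h inv (+ suc n)      = trans (inv (+ n)) (shift-invariant⇒constant h inv (+ n))
shift-invariant⇒constant h inv -[1+ zero ]    = sym (inv -[1+ zero ])
shift-invariant⇒constant h inv -[1+ suc n ]   = trans (sym (inv -[1+ suc n ])) (shift-invariant⇒constant h inv -[1+ n ])

reflective-suc : ∀ m r → Reflective m r → reflection-defect (suc m) r (+ 0) ≡ 0ℚ → Reflective (suc m) r
reflective-suc m r reflect defect₀ a = x∙y⁻¹≈ε⇒x≈y _ _ (trans
  (shift-invariant⇒constant (reflection-defect (suc m) r) (reflection-defect-shift m r reflect) a)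
  defect₀)

Σ<-Φ-reverse : ∀ m r → Σ< (suc m) (λ a → Φ m r (+ (m ℕ.+ r) ℤ.- + a)) ≡ Σ< (suc m) (λ a → Φ m r (+ (r ℕ.+ a)))
Σ<-Φ-reverse m r =
  trans (Σ<-cong (suc m) (λ a a<1+m → cong (Φ m r) (reflected-index a (ℕP.≤-pred a<1+m))))
        (Σ<-reverse (suc m) (λ a → Φ m r (+ (r ℕ.+ a))))
  where
  reflected-index : ∀ a → a ≤ m → + (m ℕ.+ r) ℤ.- + a ≡ + (r ℕ.+ (m ∸ a))
  reflected-index a a≤m = begin
    + (m ℕ.+ r) ℤ.- + a   ≡⟨ ℤP.m-n≡m⊖n (m ℕ.+ r) a ⟩
    (m ℕ.+ r) ℤ.⊖ a       ≡⟨ ℤP.⊖-≥ (ℕP.≤-trans a≤m (ℕP.m≤m+n m r)) ⟩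
    + (m ℕ.+ r ∸ a)       ≡⟨ cong +_ (trans (ℕP.+-∸-comm r a≤m) (ℕP.+-comm (m ∸ a) r)) ⟩
    + (r ℕ.+ (m ∸ a))     ∎
    where open ≡-Reasoning

Φ-0-at-0 : ∀ m → Φ m 0 (+ 0) ≡ B m
Φ-0-at-0 m = trans (Φ-at-0 m 0) (trans (cong (_* B m) (weight-0 m)) (ℚP.*-identityˡ (B m)))

Σ<-Φ-row≡0 : ∀ m → Σ< (suc (suc m)) (λ a → Φ (suc m) 0 (+ a)) ≡ 0ℚ
Σ<-Φ-row≡0 m = identityʳ-unique (B M′) S (begin
  B M′ + S                  ≡⟨ cong (_+ S) (Φ-0-at-0 M′) ⟨
  Φ M′ 0 (+ 0) + S          ≡⟨ Σ<-telescope (λ n → Φ M′ 0 (+ n)) (λ n → Φ M 0 (+ n)) (λ n → Φ-pascal M 0 (+ n)) M′ ⟨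
  Φ M′ 0 (+ M′)             ≡⟨ cong (λ k → Φ M′ 0 (+ k)) (ℕP.+-identityʳ M′) ⟨
  Φ M′ 0 (+ (M′ ℕ.+ 0))     ≡⟨ Φ-at-top M′ 0 ⟩
  weight 0 M′ * ΣCB M′      ≡⟨ cong₂ _*_ (weight-0 M′) (ΣCB≡B m) ⟩
  1ℚ * B M′                 ≡⟨ ℚP.*-identityˡ (B M′) ⟩
  B M′                      ∎)
  where
  open ≡-Reasoning
  M = suc m
  M′ = suc M
  S = Σ< M′ (λ a → Φ M 0 (+ a))

reflective-at-0 : ∀ m → Reflective m 0
reflective-at-0 zero    = reflective-0 0
reflective-at-0 (suc m) = reflective-suc m 0 (reflective-at-0 m) (*-cancelʳ-ι-suc M (begin
  d₀ * ι (+ suc M)                                ≡⟨ ℚP.*-comm d₀ (ι (+ suc M)) ⟩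
  ι (+ suc M) * d₀                                ≡⟨ Σ<-const (suc M) d₀ ⟨
  Σ< (suc M) (λ _ → d₀)                           ≡⟨ Σ<-cong (suc M) (λ a _ → defect-constant (+ a)) ⟨
  Σ< (suc M) (λ a → reflection-defect M 0 (+ a))  ≡⟨ Σ<-linear (suc M) s row reflected-row ⟩
  S - s * Σ< (suc M) reflected-row                ≡⟨ cong (λ t → S - s * t) (Σ<-Φ-reverse M 0) ⟩
  S - s * S                                       ≡⟨ cong (λ t → t - s * t) (Σ<-Φ-row≡0 m) ⟩
  0ℚ - s * 0ℚ                                     ≡⟨ solve 2 (λ s c → con 0ℚ :- s :* con 0ℚ := con 0ℚ :* c)
                                                       refl s (ι (+ suc M)) ⟩
  0ℚ * ι (+ suc M)                                ∎))
  where
  open ≡-Reasoning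
  M = suc m
  s = (- 1ℚ) ^ M
  d₀ = reflection-defect M 0 (+ 0)
  row = λ (a : ℕ) → Φ M 0 (+ a)
  reflected-row = λ (a : ℕ) → Φ M 0 (+ (M ℕ.+ 0) ℤ.- + a)
  S = Σ< (suc M) row
  defect-constant : ∀ a → reflection-defect M 0 a ≡ d₀
  defect-constant =
    shift-invariant⇒constant (reflection-defect M 0) (reflection-defect-shift m 0 (reflective-at-0 m))

ΣCB-reflect : ∀ m → ΣCB m ≡ (- 1ℚ) ^ m * B m
ΣCB-reflect m = begin
  ΣCB m                                    ≡⟨ ℚP.*-identityˡ (ΣCB m) ⟨
  1ℚ * ΣCB m                               ≡⟨ cong (_* ΣCB m) (weight-0 m) ⟨
  weight 0 m * ΣCB m                       ≡⟨ Φ-at-top m 0 ⟨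
  Φ m 0 (+ (m ℕ.+ 0))                      ≡⟨ reflective-at-0 m (+ (m ℕ.+ 0)) ⟩
  s * Φ m 0 (+ (m ℕ.+ 0) ℤ.- + (m ℕ.+ 0))  ≡⟨ cong (λ c → s * Φ m 0 c) (ℤP.+-inverseʳ (+ (m ℕ.+ 0))) ⟩
  s * Φ m 0 (+ 0)                          ≡⟨ cong (s *_) (Φ-0-at-0 m) ⟩
  s * B m                                  ∎
  where
  open ≡-Reasoning
  s = (- 1ℚ) ^ m

reflective : ∀ m r → Reflective m r
reflective zero    r = reflective-0 r
reflective (suc m) r = reflective-suc m r (reflective m r) (begin
  Φ M r (+ 0) - s * Φ M r (+ (M ℕ.+ r) ℤ.- + 0)
    ≡⟨ cong (λ c → Φ M r (+ 0) - s * Φ M r c) (ℤP.+-identityʳ (+ (M ℕ.+ r))) ⟩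
  Φ M r (+ 0) - s * Φ M r (+ (M ℕ.+ r))
    ≡⟨ cong₂ (λ u v → u - s * v) (Φ-at-0 M r) (trans (Φ-at-top M r) (cong (w *_) (ΣCB-reflect M))) ⟩
  w * B M - s * (w * (s * B M))
    ≡⟨ solve 3 (λ w b s → w :* b :- s :* (w :* (s :* b)) := w :* b :- (s :* s) :* (w :* b)) refl w (B M) s ⟩
  w * B M - (s * s) * (w * B M)
    ≡⟨ cong (λ t → w * B M - t * (w * B M)) ([-1]^m*[-1]^m≡1 M) ⟩
  w * B M - 1ℚ * (w * B M)
    ≡⟨ solve 1 (λ x → x :- con 1ℚ :* x := con 0ℚ) refl (w * B M) ⟩
  0ℚ ∎)
  where
  open ≡-Reasoning
  M = suc m
  s = (- 1ℚ) ^ M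
  w = weight r M

-- The inner sum of F and G at s = suc j, as Defs writes it.
inner : ℕ → ℕ → ℤ → ℚ
inner m j a = Σ< (suc m) (λ n → binom a (m ∸ n) * ι (+ ((n ℕ.+ 2 ℕ.* suc j ∸ 2) C n)) * B n)

inner≡Φ : ∀ m j a → inner m j a ≡ Φ m (2 ℕ.* j) a
inner≡Φ m j a = Σ<-cong (suc m) (λ n _ → cong (λ k → binom a (m ∸ n) * ι (+ (k C n)) * B n) (index n))
  where
  regroup : ∀ n j → n ℕ.+ 2 ℕ.* suc j ≡ n ℕ.+ 2 ℕ.* j ℕ.+ 2
  regroup = ℕsolve-∀
  index : ∀ n → n ℕ.+ 2 ℕ.* suc j ∸ 2 ≡ n ℕ.+ 2 ℕ.* j
  index n = trans (cong (_∸ 2) (regroup n j)) (ℕP.m+n∸n≡m (n ℕ.+ 2 ℕ.* j) 2)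

inner-reflect-K≡1+j+t : ∀ j t a →
  let k = 2 ℕ.* (suc j ℕ.+ t) ℕ.+ 1 ; m = k ∸ 2 ℕ.* suc j in
  inner m j a ≡ - inner m j ((+ k ℤ.- + 2) ℤ.- a)
inner-reflect-K≡1+j+t j t a = begin
  inner m j a                         ≡⟨ inner≡Φ m j a ⟩
  Φ m r a                             ≡⟨ reflective m r a ⟩
  (- 1ℚ) ^ m * Φ m r (+ (m ℕ.+ r) ℤ.- a)
                                      ≡⟨ cong₂ (λ s c → s * Φ m r (c ℤ.- a)) [-1]^m≡-1 m+r≡k-2 ⟩
  - 1ℚ * Φ m r (k-2 ℤ.- a)            ≡⟨ solve 1 (λ x → :- con 1ℚ :* x := :- x) refl (Φ m r (k-2 ℤ.- a)) ⟩
  - Φ m r (k-2 ℤ.- a)                 ≡⟨ cong -_ (inner≡Φ m j (k-2 ℤ.- a)) ⟨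
  - inner m j (k-2 ℤ.- a)             ∎
  where
  open ≡-Reasoning
  k = 2 ℕ.* (suc j ℕ.+ t) ℕ.+ 1
  m = k ∸ 2 ℕ.* suc j
  r = 2 ℕ.* j
  k-2 = + k ℤ.- + 2
  k≡2sj+1+2t : ∀ j t → 2 ℕ.* (suc j ℕ.+ t) ℕ.+ 1 ≡ 2 ℕ.* suc j ℕ.+ suc (t ℕ.+ t)
  k≡2sj+1+2t = ℕsolve-∀
  k≡2+1+2t+r : ∀ j t → 2 ℕ.* (suc j ℕ.+ t) ℕ.+ 1 ≡ 2 ℕ.+ (suc (t ℕ.+ t) ℕ.+ 2 ℕ.* j)
  k≡2+1+2t+r = ℕsolve-∀
  m≡1+2t : m ≡ suc (t ℕ.+ t)
  m≡1+2t = trans (cong (_∸ 2 ℕ.* suc j) (k≡2sj+1+2t j t)) (ℕP.m+n∸m≡n (2 ℕ.* suc j) (suc (t ℕ.+ t)))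
  [-1]^m≡-1 : (- 1ℚ) ^ m ≡ - 1ℚ
  [-1]^m≡-1 = trans (cong ((- 1ℚ) ^_) m≡1+2t)
                    (trans (cong (- 1ℚ *_) ([-1]^[t+t]≡1 t)) (ℚP.*-identityʳ (- 1ℚ)))
  2+x-2≡x : ∀ x → + 2 ℤ.+ x ℤ.- + 2 ≡ x
  2+x-2≡x = solve-∀
  m+r≡k-2 : + (m ℕ.+ r) ≡ k-2
  m+r≡k-2 = begin
    + (m ℕ.+ r)                           ≡⟨ cong (λ n → + (n ℕ.+ r)) m≡1+2t ⟩
    + (suc (t ℕ.+ t) ℕ.+ r)               ≡⟨ 2+x-2≡x (+ (suc (t ℕ.+ t) ℕ.+ r)) ⟨
    + (2 ℕ.+ (suc (t ℕ.+ t) ℕ.+ r)) ℤ.- + 2 ≡⟨ cong (λ n → + n ℤ.- + 2) (k≡2+1+2t+r j t) ⟨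
    k-2                                   ∎

inner-reflect : ∀ K j a → suc j ≤ K →
  let m = 2 ℕ.* K ℕ.+ 1 ∸ 2 ℕ.* suc j in
  inner m j a ≡ - inner m j ((+ (2 ℕ.* K ℕ.+ 1) ℤ.- + 2) ℤ.- a)
inner-reflect K j a j<K with ℕP.m≤n⇒∃[o]m+o≡n j<K
... | t , refl = inner-reflect-K≡1+j+t j t a

proposition1 : (K : ℕ) → 2 ≤ K → (i : ℤ) → (x y : ℚ) → F K i x y ≡ G K i x y
proposition1 K _ i x y = Σ<-cong (K ∸ 1) λ j j<K∸1 →
  cong (λ c → c * (x ^ (2 ℕ.* K ∸ 2 ℕ.* suc j)) * (y ^ (2 ℕ.* suc j ∸ 1)))
       (coefficients-swap j (inner-reflect K j i (ℕP.≤-trans j<K∸1 (ℕP.m∸n≤m K 1))))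
  where
  -- -[1+ 1 ] / d is definitionally - (+ 2 / d).
  coefficients-swap : ∀ j {X Y} → X ≡ - Y → (-[1+ 1 ] / suc (2 ℕ.* j)) * X ≡ (+ 2 / suc (2 ℕ.* j)) * Y
  coefficients-swap j {Y = Y} refl =
    solve 2 (λ q Y → (:- q) :* (:- Y) := q :* Y) refl (+ 2 / suc (2 ℕ.* j)) Y
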